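{- Let $m\ge 3$ and $n\ge 6$. If $n\equiv 4 \pmod 6$, then $\gamma_{r2}(C_{m} \Box C_n) \le \left\lceil \frac{m}{3}\right\rceil (n+2)$. Otherwise, $\gamma_{r2}(C_{m} \Box C_n) \le \left\lceil \frac{m}{3}\right\rceil (n+1)$.
   Context: A 2-rainbow dominating function (2RDF) of a graph $G$ assigns to each vertex a subset of $\{1,2\}$ so that every vertex $v$ with $f(v)=\emptyset$ satisfies $\bigcup_{u\in N(v)} f(u)=\{1,2\}$; its weight is $\sum_v |f(v)|$ and $\gamma_{r2}(G)$ is the minimum weight of a 2RDF of $G$. $C_m \Box C_n$ is the Cartesian product of the cycles $C_m$ and $C_n$. -}

module Defs where

open import Data.Nat using (ℕ; zero; suc; _+_; _*_; _≤_; _/_; _%_; NonZero)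
open import Data.Nat.Properties using ()
open import Data.Fin using (Fin; toℕ)
open import Data.Bool using (Bool; true; false)
open import Data.Product using (_×_; _,_; ∃-syntax; Σ-syntax)
open import Data.Sum using (_⊎_)
open import Data.List using (List; map; allFin; concatMap)
open import Data.Nat.ListAction using (sum)
open import Relation.Binary.PropositionalEquality using (_≡_)

-- A subset of {1,2}: (contains 1 , contains 2)
record Label : Set where
  constructor ⟨_,_⟩
  field
    has1 : Bool
    has2 : Bool
open Label public

size : Label → ℕ
size ⟨ a , b ⟩ = b2n a + b2n b
  where
  b2n : Bool → ℕ
  b2n true  = 1
  b2n false = 0

IsEmpty : Label → Set
IsEmpty l = (has1 l ≡ false) × (has2 l ≡ false)

CycleAdj : (n : ℕ) → .{{NonZero n}} → Fin n → Fin n → Set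
CycleAdj n i j = ((suc (toℕ i)) % n ≡ toℕ j) ⊎ ((suc (toℕ j)) % n ≡ toℕ i)

Vertex : ℕ → ℕ → Set
Vertex m n = Fin m × Fin n

TorusAdj : (m n : ℕ) → .{{NonZero m}} → .{{NonZero n}} →
           Vertex m n → Vertex m n → Set
TorusAdj m n (i , j) (i' , j') =
  ((i ≡ i') × CycleAdj n j j') ⊎ (CycleAdj m i i' × (j ≡ j'))

Is2RDF : (m n : ℕ) → .{{NonZero m}} → .{{NonZero n}} →
         (Vertex m n → Label) → Set
Is2RDF m n f = ∀ v → IsEmpty (f v) →
  (∃[ u ] (TorusAdj m n v u × has1 (f u) ≡ true)) ×
  (∃[ u ] (TorusAdj m n v u × has2 (f u) ≡ true))

weight : (m n : ℕ) → (Vertex m n → Label) → ℕ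
weight m n f = sum (concatMap (λ i → map (λ j → size (f (i , j))) (allFin n)) (allFin m))

γr2≤ : (m n : ℕ) → .{{NonZero m}} → .{{NonZero n}} → ℕ → Set
γr2≤ m n k = Σ[ f ∈ (Vertex m n → Label) ] (Is2RDF m n f × weight m n f ≤ k)

ceil3 : ℕ → ℕ
ceil3 m = (m + 2) / 3

module Submission where

-- Away from the seams, vertex (a , b) is labelled {1} or {2} according to the parity of b
-- when b ≡ a (mod 3), and ∅ otherwise. An empty vertex then has a labelled neighbour
-- (a , b ± 1) and a labelled neighbour (a ± 1 , b), in columns of opposite parity, so it sees
-- both colours; and any three consecutive rows carry one label per column. To close up the
-- torus when 3 ∤ m or 6 ∤ n, the last row is made fully alternating (m ≡ 1 mod 3) or
-- alternating off the columns ≡ 0 mod 3 (m ≡ 2 mod 3), and in the last column the rows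
-- ≡ 2 (mod 3) and the last row receive an extra 2, plus a 1 if that column is ≡ 3 (mod 6),
-- i.e. n ≡ 4 (mod 6). Splitting the rows into ⌈m/3⌉ blocks of at most three, each block then
-- weighs at most n + 1, resp. n + 2. The labels around a vertex depend only on the residues
-- and seam status of the adjacent rows and columns, so domination and the column loads of the
-- blocks are finite checks.

open import Defs
open import Data.Bool using (Bool; true; false; T; not; _∧_; _∨_; if_then_else_)
open import Data.Bool.ListAction using (all; any)
open import Data.Bool.Properties using (T-∧; T-≡)
open import Data.Fin using (Fin; zero; suc; toℕ; fromℕ; fromℕ<; inject₁)
open import Data.Fin.Properties using (toℕ<n; toℕ-fromℕ; toℕ-fromℕ<; toℕ-inject₁)
open import Data.List using (List; []; _∷_; map; allFin; concatMap; tabulate; cartesianProduct)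
open import Data.List.Properties using (map-tabulate)
open import Data.List.Membership.Propositional using (_∈_)
open import Data.List.Membership.Propositional.Properties using (∈-allFin; ∈-cartesianProduct⁺)
open import Data.List.Relation.Unary.All using (All; []; _∷_; lookup; lookupAny)
open import Data.List.Relation.Unary.All.Properties using (all⁺)
open import Data.List.Relation.Unary.Any using (here; there)
open import Data.List.Relation.Unary.Any.Properties using (any⁻; map⁻)
open import Data.Nat using (ℕ; zero; suc; _+_; _*_; _≤_; _<_; _%_; _≟_; _≡ᵇ_; _≤ᵇ_; NonZero)
open import Data.Nat using (z≤n; s≤s; s≤s⁻¹; z<s; s<s)
open import Data.Nat.Properties
open import Data.Nat.DivMod
  using (m%n<n; n%n≡0; m<n⇒m%n≡m; m%n%n≡m%n; %-distribˡ-+; m/n≡1+[m∸n]/n)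
open import Data.Nat.GeneralisedArithmetic using (fold)
open import Data.Nat.ListAction using (sum)
open import Data.Nat.ListAction.Properties using (sum-++)
open import Data.Nat.Tactic.RingSolver using (solve-∀)
open import Data.Product using (_×_; _,_; ∃-syntax; ∃₂)
open import Data.Sum using (inj₁; inj₂)
open import Data.Unit using (tt)
open import Function using (_∘_; Equivalence)
open import Relation.Binary.PropositionalEquality
open import Relation.Nullary using (¬_)
open import Relation.Nullary.Decidable using (does; dec-true; dec-false)

∑< : ℕ → (ℕ → ℕ) → ℕ
∑< zero    h = 0
∑< (suc n) h = ∑< n h + h n

syntax ∑< n (λ i → e) = ∑[ i < n ] e

∑-cong< : ∀ n {g h : ℕ → ℕ} → (∀ {i} → i < n → g i ≡ h i) → ∑< n g ≡ ∑< n h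
∑-cong< zero    eq = refl
∑-cong< (suc n) eq = cong₂ _+_ (∑-cong< n (eq ∘ m<n⇒m<1+n)) (eq ≤-refl)

∑-mono : ∀ n {g h : ℕ → ℕ} → (∀ i → g i ≤ h i) → ∑< n g ≤ ∑< n h
∑-mono zero    le = z≤n
∑-mono (suc n) le = +-mono-≤ (∑-mono n le) (le n)

∑-const : ∀ n c → ∑[ _ < n ] c ≡ n * c
∑-const zero    c = refl
∑-const (suc n) c = trans (cong (_+ c) (∑-const n c)) (+-comm (n * c) c)

∑-distrib-+ : ∀ n (g h : ℕ → ℕ) → ∑[ i < n ] (g i + h i) ≡ ∑< n g + ∑< n h
∑-distrib-+ zero    g h = refl
∑-distrib-+ (suc n) g h =
  trans (cong (_+ (g n + h n)) (∑-distrib-+ n g h)) (interchange (∑< n g) (∑< n h) (g n) (h n))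
  where
  interchange : ∀ a b c d → (a + b) + (c + d) ≡ (a + c) + (b + d)
  interchange = solve-∀

∑-comm : ∀ m n (g : ℕ → ℕ → ℕ) →
  ∑[ a < m ] ∑[ b < n ] g a b ≡ ∑[ b < n ] ∑[ a < m ] g a b
∑-comm zero    n g = trans (sym (*-zeroʳ n)) (sym (∑-const n 0))
∑-comm (suc m) n g = trans (cong (_+ ∑[ b < n ] g m b) (∑-comm m n g))
                           (sym (∑-distrib-+ n (λ b → ∑[ a < m ] g a b) (g m)))

∑-unconsˡ : ∀ n (h : ℕ → ℕ) → ∑< (suc n) h ≡ h 0 + ∑[ i < n ] h (suc i)
∑-unconsˡ zero    h = sym (+-identityʳ (h 0))
∑-unconsˡ (suc n) h = trans (cong (_+ h (suc n)) (∑-unconsˡ n h)) (+-assoc (h 0) _ _)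

sum-concatMap : ∀ {A : Set} (g : A → List ℕ) xs →
  sum (concatMap g xs) ≡ sum (map (sum ∘ g) xs)
sum-concatMap g []       = refl
sum-concatMap g (x ∷ xs) = trans (sum-++ (g x) _) (cong (sum (g x) +_) (sum-concatMap g xs))

sum-map-allFin : ∀ n (h : ℕ → ℕ) → sum (map (h ∘ toℕ) (allFin n)) ≡ ∑< n h
sum-map-allFin n h =
  trans (cong sum (map-tabulate {n = n} (λ i → i) (h ∘ toℕ))) (sum-tabulate n h)
  where
  sum-tabulate : ∀ n (h : ℕ → ℕ) → sum (tabulate {n = n} (h ∘ toℕ)) ≡ ∑< n h
  sum-tabulate zero    h = refl
  sum-tabulate (suc n) h = trans (cong (h 0 +_) (sum-tabulate n (h ∘ suc))) (sym (∑-unconsˡ n h))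

weight-∑ : ∀ m n (L : ℕ → ℕ → Label) →
  weight m n (λ (i , j) → L (toℕ i) (toℕ j)) ≡ ∑[ a < m ] ∑[ b < n ] size (L a b)
weight-∑ m n L = begin
  sum (concatMap (λ i → map (λ j → size (L (toℕ i) (toℕ j))) (allFin n)) (allFin m))
    ≡⟨ sum-concatMap _ (allFin m) ⟩
  sum (map (λ i → sum (map (λ j → size (L (toℕ i) (toℕ j))) (allFin n))) (allFin m))
    ≡⟨ sum-map-allFin m _ ⟩
  ∑[ a < m ] sum (map (λ j → size (L a (toℕ j))) (allFin n))
    ≡⟨ ∑-cong< m (λ {a} _ → sum-map-allFin n (λ b → size (L a b))) ⟩
  ∑[ a < m ] ∑[ b < n ] size (L a b) ∎
  where open ≡-Reasoning

cycleSuc : ∀ {N} .{{_ : NonZero N}} → Fin N → Fin N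
cycleSuc {N} j = fromℕ< (m%n<n (suc (toℕ j)) N)

cyclePred : ∀ {N} → Fin N → Fin N
cyclePred {suc N} zero    = fromℕ N
cyclePred         (suc i) = inject₁ i

toℕ-cycleSuc : ∀ {N} .{{_ : NonZero N}} (j : Fin N) → toℕ (cycleSuc j) ≡ suc (toℕ j) % N
toℕ-cycleSuc j = toℕ-fromℕ< _

[1+m%n]%n≡[1+m]%n : ∀ m n .{{_ : NonZero n}} → suc (m % n) % n ≡ suc m % n
[1+m%n]%n≡[1+m]%n m n = begin
  (1 + m % n) % n         ≡⟨ %-distribˡ-+ 1 (m % n) n ⟩
  (1 % n + m % n % n) % n ≡⟨ cong (λ x → (1 % n + x) % n) (m%n%n≡m%n m n) ⟩
  (1 % n + m % n) % n     ≡⟨ %-distribˡ-+ 1 m n ⟨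
  (1 + m) % n             ∎
  where open ≡-Reasoning

toℕ-fold-cycleSuc : ∀ {N} b → toℕ (fold (zero {N}) cycleSuc b) ≡ b % suc N
toℕ-fold-cycleSuc     zero    = refl
toℕ-fold-cycleSuc {N} (suc b) = begin
  toℕ (cycleSuc (fold zero cycleSuc b))    ≡⟨ toℕ-cycleSuc _ ⟩
  suc (toℕ (fold zero cycleSuc b)) % suc N ≡⟨ cong (λ x → suc x % suc N) (toℕ-fold-cycleSuc b) ⟩
  suc (b % suc N) % suc N                  ≡⟨ [1+m%n]%n≡[1+m]%n b (suc N) ⟩
  suc b % suc N                            ∎
  where open ≡-Reasoning

cycleSuc-adjacent : ∀ {N} .{{_ : NonZero N}} (j : Fin N) → CycleAdj N j (cycleSuc j)
cycleSuc-adjacent j = inj₁ (sym (toℕ-cycleSuc j))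

cyclePred-adjacent : ∀ {N} .{{_ : NonZero N}} (j : Fin N) → CycleAdj N j (cyclePred j)
cyclePred-adjacent {suc N} zero    =
  inj₂ (trans (cong (λ x → suc x % suc N) (toℕ-fromℕ N)) (n%n≡0 (suc N)))
cyclePred-adjacent {suc N} (suc i) =
  inj₂ (trans (cong (λ x → suc x % suc N) (toℕ-inject₁ i)) (m<n⇒m%n≡m (s<s (toℕ<n i))))

module _ {m n : ℕ} .{{_ : NonZero m}} .{{_ : NonZero n}} where

  torusNeighbours : Vertex m n → List (Vertex m n)
  torusNeighbours (i , j) =
    (cyclePred i , j) ∷ (cycleSuc i , j) ∷ (i , cyclePred j) ∷ (i , cycleSuc j) ∷ []

  torusNeighbours-adjacent : ∀ v → All (TorusAdj m n v) (torusNeighbours v)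
  torusNeighbours-adjacent (i , j) =
    inj₂ (cyclePred-adjacent i , refl) ∷ inj₂ (cycleSuc-adjacent i , refl) ∷
    inj₁ (refl , cyclePred-adjacent j) ∷ inj₁ (refl , cycleSuc-adjacent j) ∷ []

  neighbour-with : (f : Vertex m n → Label) (colour : Label → Bool) (v : Vertex m n) →
    T (any colour (map f (torusNeighbours v))) → ∃[ u ] (TorusAdj m n v u × colour (f u) ≡ true)
  neighbour-with f colour v seen =
    let coloured-neighbour = map⁻ {f = f} (any⁻ colour (map f (torusNeighbours v)) seen)
        (adjacent , coloured) = lookupAny (torusNeighbours-adjacent v) coloured-neighbour
    in _ , adjacent , Equivalence.to T-≡ coloured

nonEmptyᵇ : Label → Bool
nonEmptyᵇ l = has1 l ∨ has2 l

rainbowDominatedᵇ : Label → List Label → Bool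
rainbowDominatedᵇ l ls = nonEmptyᵇ l ∨ (any has1 ls ∧ any has2 ls)

sees-both-colours : ∀ {l} ls → IsEmpty l → T (rainbowDominatedᵇ l ls) →
  T (any has1 ls) × T (any has2 ls)
sees-both-colours ls (refl , refl) dominated = Equivalence.to T-∧ dominated

is2RDF-fromNeighbours : ∀ {m n} .{{_ : NonZero m}} .{{_ : NonZero n}} (f : Vertex m n → Label) →
  (∀ v → T (rainbowDominatedᵇ (f v) (map f (torusNeighbours v)))) → Is2RDF m n f
is2RDF-fromNeighbours f dominated v empty =
  let (sees1 , sees2) = sees-both-colours (map f (torusNeighbours v)) empty (dominated v)
  in neighbour-with f has1 v sees1 , neighbour-with f has2 v sees2

record Finite (A : Set) : Set where
  field
    elements : List A
    complete : ∀ x → x ∈ elements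

open Finite {{...}}

decide : ∀ {A : Set} {{_ : Finite A}} (p : A → Bool) → T (all p elements) → ∀ x → T (p x)
decide p ok x = lookup (all⁺ p elements ok) (complete x)

data Spot : Set where
  inner      : Bool → Spot
  first last : Spot

instance
  Finite-Fin : ∀ {n} → Finite (Fin n)
  Finite-Fin = record { elements = allFin _ ; complete = ∈-allFin }

  Finite-Bool : Finite Bool
  Finite-Bool = record
    { elements = true ∷ false ∷ []
    ; complete = λ where
        true  → here refl
        false → there (here refl)
    }

  Finite-Spot : Finite Spot
  Finite-Spot = record
    { elements = inner true ∷ inner false ∷ first ∷ last ∷ []
    ; complete = λ where
        (inner true)  → here refl
        (inner false) → there (here refl)
        first         → there (there (here refl))
        last          → there (there (there (here refl)))
    }

  Finite-× : ∀ {A B : Set} {{_ : Finite A}} {{_ : Finite B}} → Finite (A × B)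
  Finite-× = record
    { elements = cartesianProduct elements elements
    ; complete = λ (x , y) → ∈-cartesianProduct⁺ (complete x) (complete y)
    }

module Coordinate {K : Set} (origin : K) (next : K → K) where

  counter : ℕ → K
  counter = fold origin next

  Position : Set
  Position = K × Bool

  position : ℕ → ℕ → Position
  position ℓ b = counter b , does (b ≟ ℓ)

  position-inner : ∀ {ℓ b} → b < ℓ → position ℓ b ≡ (counter b , false)
  position-inner {ℓ} {b} b<ℓ = cong (counter b ,_) (dec-false (b ≟ ℓ) (<⇒≢ b<ℓ))

  position-last : ∀ {ℓ b} → b ≡ ℓ → position ℓ b ≡ (counter b , true)
  position-last {ℓ} {b} b≡ℓ = cong (counter b ,_) (dec-true (b ≟ ℓ) b≡ℓ)

  Window : Set
  Window = Position × Position × Position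

  window : K → Spot → Window
  window c (inner nextIsLast) = (c , false) , (next c , false) , (next (next c) , nextIsLast)
  window c first              = (c , true)  , (origin , false) , (next origin , false)
  window c last               = (c , false) , (next c , true)  , (origin , false)

  windowAt : ∀ {ℓ} → Fin (suc ℓ) → Window
  windowAt {ℓ} j =
    position ℓ (toℕ (cyclePred j)) , position ℓ (toℕ j) , position ℓ (toℕ (cycleSuc j))

  windowAt-spot : ∀ {ℓ} → 2 ≤ ℓ → (j : Fin (suc ℓ)) → ∃₂ λ c s → windowAt j ≡ window c s
  windowAt-spot {ℓ} (s≤s (s≤s _)) zero =
    _ , first , cong₂ _,_ (position-last (toℕ-fromℕ ℓ))
                  (cong₂ _,_ (position-inner {ℓ} {0} z<s) (position-inner {ℓ} {1} (s<s z<s)))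
  windowAt-spot {ℓ@(suc ℓ₀)} _ (suc i) rewrite toℕ-inject₁ i | toℕ-cycleSuc (suc i)
    with m≤n⇒m<n∨m≡n (s≤s⁻¹ (toℕ<n i))
  ... | inj₁ 1+i<ℓ =
    _ , inner _ , cong₂ _,_ (position-inner (m<n⇒m<1+n 1+i<ℓ))
                    (cong₂ _,_ (position-inner (s<s 1+i<ℓ))
                               (cong (position ℓ) (m<n⇒m%n≡m (s<s (s<s 1+i<ℓ)))))
  ... | inj₂ i≡ℓ₀ =
    _ , last , cong₂ _,_ (position-inner (toℕ<n i))
                 (cong₂ _,_ (position-last (cong suc i≡ℓ₀)) wraps-to-origin)
    where
    wraps-to-origin : position ℓ (suc (suc (toℕ i)) % suc ℓ) ≡ (origin , false)
    wraps-to-origin = begin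
      position ℓ (suc (suc (toℕ i)) % suc ℓ)
        ≡⟨ cong (λ x → position ℓ (suc (suc x) % suc ℓ)) i≡ℓ₀ ⟩
      position ℓ (suc ℓ % suc ℓ)
        ≡⟨ cong (position ℓ) (n%n≡0 (suc ℓ)) ⟩
      position ℓ 0
        ≡⟨ position-inner {ℓ} {0} z<s ⟩
      (origin , false) ∎
      where open ≡-Reasoning

module Rows    = Coordinate (zero {2}) cycleSuc
module Columns = Coordinate (zero {5}) cycleSuc

∅ : Label
∅ = ⟨ false , false ⟩

_∪_ : Label → Label → Label
⟨ a , b ⟩ ∪ ⟨ a′ , b′ ⟩ = ⟨ a ∨ a′ , b ∨ b′ ⟩

parityColour : Fin 6 → Label
parityColour c = ⟨ even , not even ⟩
  where even = toℕ c % 2 ≡ᵇ 0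

-- A last row of residue 0 or 1 means m ≡ 1 or 2 (mod 3).
supported : Rows.Position → Fin 6 → Bool
supported (zero     , true) c = true
supported (suc zero , true) c = not (toℕ c % 3 ≡ᵇ 0)
supported (r        , _   ) c = toℕ c % 3 ≡ᵇ toℕ r

seamPatch : Rows.Position → Fin 6 → Label
seamPatch (r , isLast) c = if isLast ∨ (toℕ r ≡ᵇ 2) then ⟨ toℕ c ≡ᵇ 3 , true ⟩ else ∅

label : Rows.Position → Columns.Position → Label
label row (c , false) = if supported row c then parityColour c else ∅
label row (c , true)  = label row (c , false) ∪ seamPatch row c

windowDominatedᵇ : Rows.Window → Columns.Window → Bool
windowDominatedᵇ (up , row , down) (left , column , right) =
  rainbowDominatedᵇ (label row column)
    (label up column ∷ label down column ∷ label row left ∷ label row right ∷ [])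

every-window-dominated : ∀ c s c′ s′ →
  T (windowDominatedᵇ (Rows.window c s) (Columns.window c′ s′))
every-window-dominated c s c′ s′ = decide windowsDominatedᵇ tt ((c , s) , (c′ , s′))
  where
  windowsDominatedᵇ : (Fin 3 × Spot) × (Fin 6 × Spot) → Bool
  windowsDominatedᵇ ((c , s) , (c′ , s′)) = windowDominatedᵇ (Rows.window c s) (Columns.window c′ s′)

seamCost : Fin 6 → ℕ
seamCost c = if does (toℕ c ≟ 3) then 2 else 1

capacity : Columns.Position → ℕ
capacity (c , false) = 1
capacity (c , true)  = suc (seamCost c)

load : (ℕ → Rows.Position) → ℕ → Columns.Position → ℕ
load rows j p = ∑[ a < j ] size (label (rows a) p)

fitsᵇ : (ℕ → Rows.Position) → ℕ → Bool
fitsᵇ rows j = all (λ p → load rows j p ≤ᵇ capacity p) elements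

fitsᵇ-sound : ∀ rows j → T (fitsᵇ rows j) → ∀ p → load rows j p ≤ capacity p
fitsᵇ-sound rows j fits p = ≤ᵇ⇒≤ _ _ (decide (λ p → load rows j p ≤ᵇ capacity p) fits p)

block : Fin 3 → ℕ → Rows.Position
block c a = fold c cycleSuc a , false

block-fits : ∀ c → T (fitsᵇ (block c) 3)
block-fits = decide (λ c → fitsᵇ (block c) 3) tt

tail-fits : ∀ j → j < 3 → T (fitsᵇ (Rows.position j) (suc j))
tail-fits 0 _ = tt
tail-fits 1 _ = tt
tail-fits 2 _ = tt
tail-fits (suc (suc (suc _))) (s<s (s<s (s<s ())))

cycleSuc³ : (c : Fin 3) → cycleSuc (cycleSuc (cycleSuc c)) ≡ c
cycleSuc³ zero             = refl
cycleSuc³ (suc zero)       = refl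
cycleSuc³ (suc (suc zero)) = refl

ceil3-+3 : ∀ m → ceil3 (3 + m) ≡ suc (ceil3 m)
ceil3-+3 m = m/n≡1+[m∸n]/n {3 + m + 2} (s≤s (s≤s (s≤s z≤n)))

∑-by-blocks≤ : (W : Rows.Position → ℕ) (B : ℕ) →
  (∀ c → ∑[ a < 3 ] W (block c a) ≤ B) →
  (∀ j → j < 3 → ∑[ a < suc j ] W (Rows.position j a) ≤ B) →
  ∀ k → ∑[ a < suc k ] W (Rows.position k a) ≤ ceil3 (suc k) * B
∑-by-blocks≤ W B block≤ tail≤ k = begin
  ∑[ a < suc k ] W (Rows.position k a)
    ≡⟨ cong₂ _+_ (∑-cong< k (cong W ∘ Rows.position-inner))
                 (cong W (Rows.position-last {k} refl)) ⟩
  rowsWeight k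
    ≤⟨ rowsWeight≤ k ⟩
  ceil3 (suc k) * B ∎
  where
  open ≤-Reasoning
  rowsWeight : ℕ → ℕ
  rowsWeight k = ∑[ a < k ] W (Rows.counter a , false) + W (Rows.counter k , true)
  regroup : ∀ s x y z l → (((s + x) + y) + z) + l ≡ (s + l) + ((x + y) + z)
  regroup = solve-∀
  rowsWeight≤ : ∀ k → rowsWeight k ≤ ceil3 (suc k) * B
  rowsWeight≤ 0 = ≤-trans (tail≤ 0 z<s) (m≤m+n B 0)
  rowsWeight≤ 1 = ≤-trans (tail≤ 1 (s<s z<s)) (m≤m+n B 0)
  rowsWeight≤ 2 = ≤-trans (tail≤ 2 (s<s (s<s z<s))) (m≤m+n B 0)
  rowsWeight≤ (suc (suc (suc k))) = begin
    ∑[ a < 3 + k ] W (Rows.counter a , false) + W (Rows.counter (3 + k) , true)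
      ≡⟨ cong (λ c → ∑[ a < 3 + k ] W (Rows.counter a , false) + W (c , true))
              (cycleSuc³ (Rows.counter k)) ⟩
    ∑[ a < 3 + k ] W (Rows.counter a , false) + W (Rows.counter k , true)
      ≡⟨ regroup (∑[ a < k ] W (Rows.counter a , false)) _ _ _ (W (Rows.counter k , true)) ⟩
    rowsWeight k + ∑[ a < 3 ] W (block (Rows.counter k) a)
      ≤⟨ +-mono-≤ (rowsWeight≤ k) (block≤ (Rows.counter k)) ⟩
    ceil3 (suc k) * B + B
      ≡⟨ +-comm _ B ⟩
    suc (ceil3 (suc k)) * B
      ≡⟨ cong (_* B) (ceil3-+3 (suc k)) ⟨
    ceil3 (4 + k) * B ∎

module _ (k l : ℕ) where

  labelling : Vertex (suc k) (suc l) → Label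
  labelling (i , j) = label (Rows.position k (toℕ i)) (Columns.position l (toℕ j))

  labelling-is2RDF : 2 ≤ k → 2 ≤ l → Is2RDF (suc k) (suc l) labelling
  labelling-is2RDF 2≤k 2≤l = is2RDF-fromNeighbours labelling dominated
    where
    dominated : ∀ v → T (rainbowDominatedᵇ (labelling v) (map labelling (torusNeighbours v)))
    dominated (i , j) with Rows.windowAt-spot 2≤k i | Columns.windowAt-spot 2≤l j
    ... | c , s , row≡ | c′ , s′ , column≡ =
      subst₂ (λ w w′ → T (windowDominatedᵇ w w′)) (sym row≡) (sym column≡)
             (every-window-dominated c s c′ s′)

  blockBound : ℕ
  blockBound = suc l + seamCost (Columns.counter l)

  rowWeight : Rows.Position → ℕ
  rowWeight row = ∑[ b < suc l ] size (label row (Columns.position l b))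

  ∑-capacity : ∑[ b < suc l ] capacity (Columns.position l b) ≡ blockBound
  ∑-capacity = begin
    ∑[ b < l ] capacity (Columns.position l b) + capacity (Columns.position l l)
      ≡⟨ cong₂ _+_ (∑-cong< l (cong capacity ∘ Columns.position-inner))
                   (cong capacity (Columns.position-last {l} refl)) ⟩
    ∑[ b < l ] 1 + suc (seamCost (Columns.counter l))
      ≡⟨ cong (_+ suc (seamCost (Columns.counter l))) (trans (∑-const l 1) (*-identityʳ l)) ⟩
    l + suc (seamCost (Columns.counter l))
      ≡⟨ +-suc l _ ⟩
    suc l + seamCost (Columns.counter l) ∎
    where open ≡-Reasoning

  fitting-rows-weight≤ : ∀ rows j → T (fitsᵇ rows j) →
    ∑[ a < j ] rowWeight (rows a) ≤ blockBound
  fitting-rows-weight≤ rows j fits = begin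
    ∑[ a < j ] ∑[ b < suc l ] size (label (rows a) (Columns.position l b))
      ≡⟨ ∑-comm j (suc l) _ ⟩
    ∑[ b < suc l ] load rows j (Columns.position l b)
      ≤⟨ ∑-mono (suc l) (λ b → fitsᵇ-sound rows j fits (Columns.position l b)) ⟩
    ∑[ b < suc l ] capacity (Columns.position l b)
      ≡⟨ ∑-capacity ⟩
    blockBound ∎
    where open ≤-Reasoning

  labelling-weight : weight (suc k) (suc l) labelling ≤ ceil3 (suc k) * blockBound
  labelling-weight = begin
    weight (suc k) (suc l) labelling
      ≡⟨ weight-∑ (suc k) (suc l) (λ a b → label (Rows.position k a) (Columns.position l b)) ⟩
    ∑[ a < suc k ] rowWeight (Rows.position k a)
      ≤⟨ ∑-by-blocks≤ rowWeight _
           (λ c → fitting-rows-weight≤ (block c) 3 (block-fits c))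
           (λ j j<3 → fitting-rows-weight≤ (Rows.position j) (suc j) (tail-fits j j<3)) k ⟩
    ceil3 (suc k) * blockBound ∎
    where open ≤-Reasoning

seamCost≤2 : ∀ c → seamCost c ≤ 2
seamCost≤2 c with does (toℕ c ≟ 3)
... | true  = ≤-refl
... | false = s≤s z≤n

seamCost≤1 : ∀ l → ¬ (suc l % 6 ≡ 4) → seamCost (Columns.counter l) ≤ 1
seamCost≤1 l 1+l%6≢4 =
  ≤-reflexive (cong (if_then 2 else 1) (dec-false (toℕ (Columns.counter l) ≟ 3) counter≢3))
  where
  counter≢3 : toℕ (Columns.counter l) ≢ 3
  counter≢3 counter≡3 = 1+l%6≢4 (begin
    suc l % 6       ≡⟨ [1+m%n]%n≡[1+m]%n l 6 ⟨
    suc (l % 6) % 6 ≡⟨ cong (λ x → suc x % 6) (trans (sym (toℕ-fold-cycleSuc l)) counter≡3) ⟩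
    4 ∎)
    where open ≡-Reasoning

γr2≤-torus : ∀ k l e → 2 ≤ k → 2 ≤ l → seamCost (Columns.counter l) ≤ e →
  γr2≤ (suc k) (suc l) (ceil3 (suc k) * (suc l + e))
γr2≤-torus k l e 2≤k 2≤l cost≤e =
  labelling k l ,
  labelling-is2RDF k l 2≤k 2≤l ,
  ≤-trans (labelling-weight k l) (*-monoʳ-≤ (ceil3 (suc k)) (+-monoʳ-≤ (suc l) cost≤e))

proposition6 : (m n : ℕ) → .{{_ : NonZero m}} → .{{_ : NonZero n}} → 3 ≤ m → 6 ≤ n →
    ((n % 6 ≡ 4 → γr2≤ m n (ceil3 m * (n + 2))) ×
     (¬ (n % 6 ≡ 4) → γr2≤ m n (ceil3 m * (n + 1))))
proposition6 (suc k) (suc l) (s≤s 2≤k) (s≤s 5≤l) =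
  (λ _ → γr2≤-torus k l 2 2≤k 2≤l (seamCost≤2 (Columns.counter l))) ,
  (λ n%6≢4 → γr2≤-torus k l 1 2≤k 2≤l (seamCost≤1 l n%6≢4))
  where
  2≤l : 2 ≤ l
  2≤l = ≤-trans (s≤s (s≤s z≤n)) 5≤l
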